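{- Let $\mathfrak{F}$ be a CI frame closed under copying, marginalization, intersection, and ascetic extension. Let $N$ be a finite set, $\mathcal{M}\subseteq\mathbb{S}(N)$ and $L\subseteq N$. Then the self-adhesive closure $\mathfrak{F}^{\mathrm{sa}}(\mathcal{M}|L)$ exists, and for any bijection $\varphi:N\to M$ with $N\cap M=L$ and $\varphi|_L=\mathrm{id}_L$ it equals $\big(\mathrm{cl}_{\mathfrak{F}(NM)}(\mathcal{Z})\big)^{\downarrow N}$, where $\mathcal{Z}=\mathcal{M}\cup\varphi(\mathcal{M})\cup[N\setminus M,M\setminus N\,|\,L]$.
   Context: For a finite set $N$, $\mathbb{S}(N)$ denotes the set of all CI statements $ij|K$ with $i,j\in N$ distinct and $K\subseteq N\setminus\{i,j\}$, with $ij|K$ and $ji|K$ identified; juxtaposition denotes union ($NM=N\cup M$). A CI model over $N$ is a subset of $\mathbb{S}(N)$ (also a model over any superset of $N$). A CI frame $\mathfrak{F}$ assigns to every finite set $N$ a set $\mathfrak{F}(N)$ of models over $N$ with $\mathbb{S}(N)\in\mathfrak{F}(N)$. A bijection $\varphi:N\to M$ acts by $\varphi(ij|K)=\varphi(i)\varphi(j)|\varphi(K)$; closed under copying: $\mathcal{M}\in\mathfrak{F}(N)\Rightarrow\varphi(\mathcal{M})\in\mathfrak{F}(M)$. Marginal: $\mathcal{M}^{\downarrow M}=\mathcal{M}\cap\mathbb{S}(M)$ for $M\subseteq N$; closed under marginalization if marginals of members are members. Closed under intersection: $\mathcal{M},\mathcal{A}\in\mathfrak{F}(N)\Rightarrow\mathcal{M}\cap\mathcal{A}\in\mathfrak{F}(N)$.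 Closed under ascetic extension: $N\subseteq M\Rightarrow\mathfrak{F}(N)\subseteq\mathfrak{F}(M)$. For a frame closed under intersection, $\mathrm{cl}_{\mathfrak{F}(N)}(\mathcal{M})$ is the smallest element of $\mathfrak{F}(N)$ containing $\mathcal{M}$. For pairwise disjoint $I,J,K\subseteq N$, $[I,J|K]$ denotes the set of statements $ij|L'$ with $i\in I$, $j\in J$, $K\subseteq L'\subseteq (I\cup J\cup K)\setminus\{i,j\}$, and $I\perp J\,|\,K\,[\mathcal{M}]$ means $[I,J|K]\subseteq\mathcal{M}$. For a frame closed under copying and marginalization, $\mathcal{M}\in\mathfrak{F}(N)$ is self-adhesive at $L\subseteq N$ relative to $\mathfrak{F}$ if for every bijection $\varphi:N\to M$ with $N\cap M=L$ and $\varphi|_L=\mathrm{id}_L$ there is $\mathcal{Z}\in\mathfrak{F}(NM)$ with $\mathcal{Z}^{\downarrow N}=\mathcal{M}$, $\mathcal{Z}^{\downarrow M}=\varphi(\mathcal{M})$, and $(N\setminus M)\perp(M\setminus N)\,|\,L\,[\mathcal{Z}]$. For $\mathcal{M}\subseteq\mathbb{S}(N)$ and $L\subseteq N$, the self-adhesive closure $\mathfrak{F}^{\mathrm{sa}}(\mathcal{M}|L)$ is, if it exists, the least $\mathcal{A}\in\mathfrak{F}(N)$ with $\mathcal{M}\subseteq\mathcal{A}$ that is self-adhesive at $L$ relative to $\mathfrak{F}$. -}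

module Defs where

open import Data.Nat using (ℕ; _≟_)
open import Data.List using (List; []; _∷_; _++_; map; filter)
open import Data.List.Membership.Propositional using (_∈_; _∉_)
open import Data.List.Membership.DecPropositional _≟_ using (_∈?_)
open import Data.List.Relation.Unary.Any using (Any)
open import Data.List.Relation.Binary.Subset.Propositional using (_⊆_)
open import Data.Product using (Σ; _×_; _,_)
open import Data.Sum using (_⊎_)
open import Relation.Nullary using (¬_; ¬?)
open import Relation.Binary.PropositionalEquality using (_≡_; _≢_)
open import Function.Bundles using (_⇔_)

-- Ground set: the elements of all finite sets are natural numbers.
-- A finite set is represented by a list (order / duplicates irrelevant:
-- every notion below only uses membership).

FinSet : Set
FinSet = List ℕ

_∖_ : FinSet → FinSet → FinSet
N ∖ M = filter (λ x → ¬? (x ∈? M)) N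

-- CI statements ij|K (raw syntax).  ij|K and ji|K are identified, and
-- K is taken as a set; see _≈ᶜ_.

record CI : Set where
  constructor ⟨_,_∣_⟩
  field
    left  : ℕ
    right : ℕ
    cond  : FinSet

_≈ᶜ_ : CI → CI → Set
⟨ i , j ∣ K ⟩ ≈ᶜ ⟨ i' , j' ∣ K' ⟩ =
  ((i ≡ i' × j ≡ j') ⊎ (i ≡ j' × j ≡ i')) × (K ⊆ K' × K' ⊆ K)

InS : FinSet → CI → Set
InS N ⟨ i , j ∣ K ⟩ = i ∈ N × j ∈ N × i ≢ j × K ⊆ N × i ∉ K × j ∉ K

Model : Set
Model = List CI

_∈ₘ_ : CI → Model → Set
s ∈ₘ A = Any (λ t → t ≈ᶜ s) A

_⊆ₘ_ : Model → Model → Set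
A ⊆ₘ B = ∀ s → s ∈ₘ A → s ∈ₘ B

_≐_ : Model → Model → Set
A ≐ B = A ⊆ₘ B × B ⊆ₘ A

Over : FinSet → Model → Set
Over N A = ∀ s → s ∈ₘ A → InS N s

IsMarg : Model → Model → FinSet → Set
IsMarg B A M = ∀ s → s ∈ₘ B ⇔ (s ∈ₘ A × InS M s)

mapCI : (ℕ → ℕ) → CI → CI
mapCI φ ⟨ i , j ∣ K ⟩ = ⟨ φ i , φ j ∣ map φ K ⟩

mapM : (ℕ → ℕ) → Model → Model
mapM φ = map (mapCI φ)

record IsBij (φ : ℕ → ℕ) (N M : FinSet) : Set where
  field
    maps : ∀ {x} → x ∈ N → φ x ∈ M
    inj  : ∀ {x y} → x ∈ N → y ∈ N → φ x ≡ φ y → x ≡ y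
    surj : ∀ {y} → y ∈ M → Σ ℕ (λ x → x ∈ N × φ x ≡ y)

InterIs : FinSet → FinSet → FinSet → Set
InterIs N M L = ∀ x → (x ∈ N × x ∈ M) ⇔ x ∈ L

FixesOn : (ℕ → ℕ) → FinSet → Set
FixesOn φ L = ∀ x → x ∈ L → φ x ≡ x

InBracket : FinSet → FinSet → FinSet → CI → Set
InBracket I J K s =
  Σ ℕ λ i → Σ ℕ λ j → Σ FinSet λ L' →
    s ≈ᶜ ⟨ i , j ∣ L' ⟩ × i ∈ I × j ∈ J × i ≢ j ×
    K ⊆ L' × L' ⊆ (I ++ (J ++ K)) × i ∉ L' × j ∉ L'

Perp : FinSet → FinSet → FinSet → Model → Set
Perp I J K A = ∀ s → InBracket I J K s → s ∈ₘ A

-- CI frames.  𝔉(N) is a (finite) set of models over N, given as a list;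
-- membership of a model is up to equality of models.

Frame : Set
Frame = FinSet → List Model

_∈F_ : Model → List Model → Set
A ∈F 𝓕 = Any (λ B → B ≐ A) 𝓕

record IsCIFrame (𝔉 : Frame) : Set where
  field
    over : ∀ N A → A ∈F 𝔉 N → Over N A
    full : ∀ N → Σ Model (λ A → A ∈F 𝔉 N × (∀ s → InS N s → s ∈ₘ A))

ClosedCopy : Frame → Set
ClosedCopy 𝔉 = ∀ N M φ A → IsBij φ N M → A ∈F 𝔉 N → mapM φ A ∈F 𝔉 M

ClosedMarg : Frame → Set
ClosedMarg 𝔉 = ∀ N M A → M ⊆ N → A ∈F 𝔉 N →
  Σ Model (λ B → B ∈F 𝔉 M × IsMarg B A M)

ClosedInter : Frame → Set
ClosedInter 𝔉 = ∀ N A B → A ∈F 𝔉 N → B ∈F 𝔉 N →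
  Σ Model (λ C → C ∈F 𝔉 N × (∀ s → s ∈ₘ C ⇔ (s ∈ₘ A × s ∈ₘ B)))

ClosedAscetic : Frame → Set
ClosedAscetic 𝔉 = ∀ N M A → N ⊆ M → A ∈F 𝔉 N → A ∈F 𝔉 M

IsClosure : Frame → FinSet → (CI → Set) → Model → Set
IsClosure 𝔉 N P C =
  C ∈F 𝔉 N × (∀ s → P s → s ∈ₘ C) ×
  (∀ B → B ∈F 𝔉 N → (∀ s → P s → s ∈ₘ B) → C ⊆ₘ B)

SelfAdhesive : Frame → FinSet → FinSet → Model → Set
SelfAdhesive 𝔉 N L A =
  ∀ M φ → IsBij φ N M → InterIs N M L → FixesOn φ L →
  Σ Model λ Z → Z ∈F 𝔉 (N ++ M) × IsMarg A Z N × IsMarg (mapM φ A) Z M ×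
                Perp (N ∖ M) (M ∖ N) L Z

IsSAClosure : Frame → FinSet → FinSet → Model → Model → Set
IsSAClosure 𝔉 N L 𝓜 A =
  (A ∈F 𝔉 N × 𝓜 ⊆ₘ A × SelfAdhesive 𝔉 N L A) ×
  (∀ B → B ∈F 𝔉 N → 𝓜 ⊆ₘ B → SelfAdhesive 𝔉 N L B → A ⊆ₘ B)

ZPred : Model → (ℕ → ℕ) → FinSet → FinSet → FinSet → CI → Set
ZPred 𝓜 φ N M L s = s ∈ₘ 𝓜 ⊎ (s ∈ₘ mapM φ 𝓜 ⊎ InBracket (N ∖ M) (M ∖ N) L s)

-- Fix a copy φ : N → M with N ∩ M = L and φ|L = id, let C be the closure of
-- 𝒵 = 𝓜 ∪ φ(𝓜) ∪ [N∖M, M∖N | L] in 𝔉(NM), and A = C↓N. The involution of NM exchanging x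
-- and φ x preserves 𝒵, hence, 𝔉 being closed under copying, it preserves C; so C↓M = φ(A)
-- and C witnesses that A is self-adhesive at L. Conversely, the adhesion witness of a
-- self-adhesive B ⊇ 𝓜 contains 𝒵, hence C, so A ⊆ B. Finally A does not depend on the copy:
-- for two copies φ, ψ the map that is the identity on N and ψ ∘ φ⁻¹ on M ∖ N carries one 𝒵
-- into the other. The closure exists because 𝔉(NM) is a finite list closed under intersection
-- and 𝒵 is finite, so containment of 𝒵 is decidable.

module Submission where

open import Defs
open import Data.Nat using (ℕ; suc; _+_; _≟_; s≤s)
open import Data.Nat.Properties using (+-cancelˡ-≡; m≤m+n; <⇒≱)
open import Data.Bool using (true; false; if_then_else_)
open import Data.Empty using (⊥-elim)
open import Data.List using (List; []; _∷_; _++_; map; filter; cartesianProduct; cartesianProductWith)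
open import Data.List.Extrema.Nat using (max; xs≤max)
open import Data.List.Properties using (map-id; map-∘; map-cong-local)
open import Data.List.Membership.Propositional using (_∈_; _∉_; find; lose)
open import Data.List.Membership.Propositional.Properties
  using (∈-map⁺; ∈-map⁻; ∈-++⁺ˡ; ∈-++⁺ʳ; ∈-++⁻; ∈-filter⁺; ∈-filter⁻;
         ∈-cartesianProduct⁺; ∈-cartesianProduct⁻; ∈-cartesianProductWith⁺; ∈-cartesianProductWith⁻)
open import Data.List.Membership.DecPropositional _≟_ using (_∈?_)
open import Data.List.Relation.Unary.All as All using (All)
open import Data.List.Relation.Unary.Any as Any using (Any; here; there)
open import Data.List.Relation.Unary.Any.Properties using (map⁺; map⁻; ++⁺ˡ; ++⁺ʳ; ++⁻)
open import Data.List.Relation.Binary.Subset.Propositional using (_⊆_)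
import Data.List.Relation.Binary.Subset.Propositional.Properties as ⊆
open import Data.List.Relation.Binary.Subset.DecPropositional _≟_ using (_⊆?_)
open import Data.Product using (Σ; _×_; _,_; proj₁; proj₂)
open import Data.Sum using (_⊎_; inj₁; inj₂)
open import Function using (_∘_; id)
open import Function.Bundles using (Equivalence; mk⇔)
open import Relation.Nullary using (Dec; yes; no; does; ¬?)
open import Relation.Nullary.Decidable using (_×-dec_; _⊎-dec_; map′)
open import Relation.Unary using (Decidable)
open import Relation.Binary.PropositionalEquality
  using (_≡_; _≢_; refl; sym; trans; cong; subst; module ≡-Reasoning)

≈ᶜ-refl : ∀ {s} → s ≈ᶜ s
≈ᶜ-refl = inj₁ (refl , refl) , id , id

≈ᶜ-sym : ∀ {s t} → s ≈ᶜ t → t ≈ᶜ s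
≈ᶜ-sym (inj₁ (refl , refl) , K⊆K′ , K′⊆K) = inj₁ (refl , refl) , K′⊆K , K⊆K′
≈ᶜ-sym (inj₂ (refl , refl) , K⊆K′ , K′⊆K) = inj₂ (refl , refl) , K′⊆K , K⊆K′

≈ᶜ-trans : ∀ {s t u} → s ≈ᶜ t → t ≈ᶜ u → s ≈ᶜ u
≈ᶜ-trans (p , K⊆K′ , K′⊆K) (q , K′⊆K′′ , K′′⊆K′) =
  pairs p q , K′⊆K′′ ∘ K⊆K′ , K′⊆K ∘ K′′⊆K′
  where
  pairs : ∀ {i j i′ j′ i′′ j′′ : ℕ} →
          (i ≡ i′ × j ≡ j′) ⊎ (i ≡ j′ × j ≡ i′) →
          (i′ ≡ i′′ × j′ ≡ j′′) ⊎ (i′ ≡ j′′ × j′ ≡ i′′) →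
          (i ≡ i′′ × j ≡ j′′) ⊎ (i ≡ j′′ × j ≡ i′′)
  pairs (inj₁ (refl , refl)) q                    = q
  pairs (inj₂ (refl , refl)) (inj₁ (refl , refl)) = inj₂ (refl , refl)
  pairs (inj₂ (refl , refl)) (inj₂ (refl , refl)) = inj₁ (refl , refl)

_≈ᶜ?_ : ∀ s t → Dec (s ≈ᶜ t)
⟨ i , j ∣ K ⟩ ≈ᶜ? ⟨ i′ , j′ ∣ K′ ⟩ =
  ((i ≟ i′ ×-dec j ≟ j′) ⊎-dec (i ≟ j′ ×-dec j ≟ i′)) ×-dec (K ⊆? K′ ×-dec K′ ⊆? K)

∈ₘ-resp-≈ᶜ : ∀ {s t A} → s ≈ᶜ t → s ∈ₘ A → t ∈ₘ A
∈ₘ-resp-≈ᶜ s≈t = Any.map (λ u≈s → ≈ᶜ-trans u≈s s≈t)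

∈⇒∈ₘ : ∀ {s A} → s ∈ A → s ∈ₘ A
∈⇒∈ₘ s∈A = lose s∈A ≈ᶜ-refl

⊆ₘ-refl : ∀ {A} → A ⊆ₘ A
⊆ₘ-refl _ = id

_⊆ₘ?_ : ∀ A B → Dec (A ⊆ₘ B)
A ⊆ₘ? B = map′ from to (All.all? (λ a → Any.any? (_≈ᶜ? a) B) A)
  where
  from : All (_∈ₘ B) A → A ⊆ₘ B
  from all s s∈A = let a , a∈A , a≈s = find s∈A in ∈ₘ-resp-≈ᶜ a≈s (All.lookup all a∈A)
  to : A ⊆ₘ B → All (_∈ₘ B) A
  to A⊆B = All.tabulate (λ a∈A → A⊆B _ (∈⇒∈ₘ a∈A))

InS-resp-≈ᶜ : ∀ {X s t} → s ≈ᶜ t → InS X s → InS X t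
InS-resp-≈ᶜ (inj₁ (refl , refl) , _ , K′⊆K) (i∈ , j∈ , i≢j , K⊆ , i∉ , j∉) =
  i∈ , j∈ , i≢j , K⊆ ∘ K′⊆K , i∉ ∘ K′⊆K , j∉ ∘ K′⊆K
InS-resp-≈ᶜ (inj₂ (refl , refl) , _ , K′⊆K) (i∈ , j∈ , i≢j , K⊆ , i∉ , j∉) =
  j∈ , i∈ , i≢j ∘ sym , K⊆ ∘ K′⊆K , j∉ ∘ K′⊆K , i∉ ∘ K′⊆K

InS-mono : ∀ {X Y s} → X ⊆ Y → InS X s → InS Y s
InS-mono X⊆Y (i∈ , j∈ , i≢j , K⊆ , i∉ , j∉) = X⊆Y i∈ , X⊆Y j∈ , i≢j , X⊆Y ∘ K⊆ , i∉ , j∉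

InjectiveOn : (ℕ → ℕ) → FinSet → Set
InjectiveOn f X = ∀ {x y} → x ∈ X → y ∈ X → f x ≡ f y → x ≡ y

mapCI-cong : ∀ f {s t} → s ≈ᶜ t → mapCI f s ≈ᶜ mapCI f t
mapCI-cong f (inj₁ (refl , refl) , K⊆K′ , K′⊆K) = inj₁ (refl , refl) , ⊆.map⁺ f K⊆K′ , ⊆.map⁺ f K′⊆K
mapCI-cong f (inj₂ (refl , refl) , K⊆K′ , K′⊆K) = inj₂ (refl , refl) , ⊆.map⁺ f K⊆K′ , ⊆.map⁺ f K′⊆K

mapCI-∘ : ∀ g f s → mapCI g (mapCI f s) ≡ mapCI (g ∘ f) s
mapCI-∘ g f ⟨ i , j ∣ K ⟩ = cong ⟨ g (f i) , g (f j) ∣_⟩ (sym (map-∘ K))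

mapCI-id : ∀ s → mapCI id s ≡ s
mapCI-id ⟨ i , j ∣ K ⟩ = cong ⟨ i , j ∣_⟩ (map-id K)

⟨⟩-cong : ∀ {i i′ j j′ K K′} → i ≡ i′ → j ≡ j′ → K ≡ K′ → ⟨ i , j ∣ K ⟩ ≡ ⟨ i′ , j′ ∣ K′ ⟩
⟨⟩-cong refl refl refl = refl

mapCI-cong-on : ∀ {X f g s} → (∀ {x} → x ∈ X → f x ≡ g x) → InS X s → mapCI f s ≡ mapCI g s
mapCI-cong-on {s = ⟨ i , j ∣ K ⟩} f≗g (i∈ , j∈ , _ , K⊆ , _) =
  ⟨⟩-cong (f≗g i∈) (f≗g j∈) (map-cong-local (All.tabulate (f≗g ∘ K⊆)))

mapCI-id-on : ∀ {X f s} → (∀ {x} → x ∈ X → f x ≡ x) → InS X s → mapCI f s ≡ s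
mapCI-id-on {s = s} f≗id s∈X = trans (mapCI-cong-on f≗id s∈X) (mapCI-id s)

InS-mapCI : ∀ {X Y f s} → (∀ {x} → x ∈ X → f x ∈ Y) → InjectiveOn f X →
            InS X s → InS Y (mapCI f s)
InS-mapCI {X} {Y} {f} {⟨ i , j ∣ K ⟩} f∈ f-inj (i∈ , j∈ , i≢j , K⊆ , i∉ , j∉) =
  f∈ i∈ , f∈ j∈ , i≢j ∘ f-inj i∈ j∈ , fK⊆Y , ∉-image i∈ i∉ , ∉-image j∈ j∉
  where
  fK⊆Y : map f K ⊆ Y
  fK⊆Y y∈fK with ∈-map⁻ f y∈fK
  ... | x , x∈K , refl = f∈ (K⊆ x∈K)
  ∉-image : ∀ {u} → u ∈ X → u ∉ K → f u ∉ map f K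
  ∉-image u∈ u∉K fu∈ with ∈-map⁻ f fu∈
  ... | x , x∈K , fu≡fx with f-inj u∈ (K⊆ x∈K) fu≡fx
  ... | refl = u∉K x∈K

∈ₘ-mapM⁺ : ∀ f {s A} → s ∈ₘ A → mapCI f s ∈ₘ mapM f A
∈ₘ-mapM⁺ f s∈A = map⁺ (Any.map (mapCI-cong f) s∈A)

∈ₘ-mapM⁻ : ∀ f {s A} → s ∈ₘ mapM f A → Σ CI λ a → a ∈ₘ A × mapCI f a ≈ᶜ s
∈ₘ-mapM⁻ f s∈fA = let a , a∈A , fa≈s = find (map⁻ s∈fA) in a , ∈⇒∈ₘ a∈A , fa≈s

mapM-mono : ∀ f {A B} → A ⊆ₘ B → mapM f A ⊆ₘ mapM f B
mapM-mono f A⊆B s s∈fA =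
  let a , a∈A , fa≈s = ∈ₘ-mapM⁻ f s∈fA in ∈ₘ-resp-≈ᶜ fa≈s (∈ₘ-mapM⁺ f (A⊆B a a∈A))

∈ₘ-mapM-id⁺ : ∀ {s A} → s ∈ₘ A → s ∈ₘ mapM id A
∈ₘ-mapM-id⁺ {s} s∈A = subst (_∈ₘ _) (mapCI-id s) (∈ₘ-mapM⁺ id s∈A)

∈ₘ-mapM-id⁻ : ∀ {s A} → s ∈ₘ mapM id A → s ∈ₘ A
∈ₘ-mapM-id⁻ s∈A with ∈ₘ-mapM⁻ id s∈A
... | a , a∈A , a≈s = ∈ₘ-resp-≈ᶜ (subst (_≈ᶜ _) (mapCI-id a) a≈s) a∈A

∈ₘ-mapM-∘ : ∀ {X A f g h s} → Over X A → (∀ {x} → x ∈ X → g (f x) ≡ h x) →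
            s ∈ₘ mapM f A → mapCI g s ∈ₘ mapM h A
∈ₘ-mapM-∘ {f = f} {g} {h} A⊆X gf≗h s∈fA with ∈ₘ-mapM⁻ f s∈fA
... | a , a∈A , fa≈s = ∈ₘ-resp-≈ᶜ (subst (_≈ᶜ mapCI g _) gfa≡ha (mapCI-cong g fa≈s)) (∈ₘ-mapM⁺ h a∈A)
  where
  gfa≡ha : mapCI g (mapCI f a) ≡ mapCI h a
  gfa≡ha = trans (mapCI-∘ g f a) (mapCI-cong-on gf≗h (A⊆X a a∈A))

Over-mapM : ∀ {X Y f A} → (∀ {x} → x ∈ X → f x ∈ Y) → InjectiveOn f X → Over X A → Over Y (mapM f A)
Over-mapM {f = f} f∈ f-inj A⊆X s s∈fA with ∈ₘ-mapM⁻ f s∈fA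
... | a , a∈A , fa≈s = InS-resp-≈ᶜ fa≈s (InS-mapCI f∈ f-inj (A⊆X a a∈A))

record InverseOn (f g : ℕ → ℕ) (X Y : FinSet) : Set where
  field
    maps-to   : ∀ {x} → x ∈ X → f x ∈ Y
    maps-from : ∀ {y} → y ∈ Y → g y ∈ X
    inverseˡ  : ∀ {x} → x ∈ X → g (f x) ≡ x
    inverseʳ  : ∀ {y} → y ∈ Y → f (g y) ≡ y

  injective : InjectiveOn f X
  injective {x} {x′} x∈ x′∈ fx≡fx′ = begin
    x          ≡⟨ inverseˡ x∈ ⟨
    g (f x)    ≡⟨ cong g fx≡fx′ ⟩
    g (f x′)   ≡⟨ inverseˡ x′∈ ⟩
    x′         ∎
    where open ≡-Reasoning

  flip : InverseOn g f Y X
  flip = record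
    { maps-to = maps-from ; maps-from = maps-to ; inverseˡ = inverseʳ ; inverseʳ = inverseˡ }

  isBij : IsBij f X Y
  isBij = record { maps = maps-to ; inj = injective ; surj = λ y∈ → _ , maps-from y∈ , inverseʳ y∈ }

  ∈ₘ-mapM⁺-inverse : ∀ {C s} → InS Y s → mapCI g s ∈ₘ C → s ∈ₘ mapM f C
  ∈ₘ-mapM⁺-inverse {C} {s} s∈Y gs∈C = subst (_∈ₘ mapM f C) fgs≡s (∈ₘ-mapM⁺ f gs∈C)
    where
    fgs≡s : mapCI f (mapCI g s) ≡ s
    fgs≡s = trans (mapCI-∘ f g s) (mapCI-id-on inverseʳ s∈Y)

  ∈ₘ-mapM⁻-inverse : ∀ {C s} → Over X C → s ∈ₘ mapM f C → mapCI g s ∈ₘ C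
  ∈ₘ-mapM⁻-inverse C⊆X s∈fC = ∈ₘ-mapM-id⁻ (∈ₘ-mapM-∘ C⊆X inverseˡ s∈fC)

module _ {f X Y} (bij : IsBij f X Y) where
  open IsBij bij

  inverseOf : ℕ → ℕ
  inverseOf y with y ∈? Y
  ... | yes y∈Y = proj₁ (surj y∈Y)
  ... | no _    = y

  IsBij⇒InverseOn : InverseOn f inverseOf X Y
  IsBij⇒InverseOn = record
    { maps-to = maps ; maps-from = maps-from ; inverseˡ = inverseˡ ; inverseʳ = inverseʳ }
    where
    maps-from : ∀ {y} → y ∈ Y → inverseOf y ∈ X
    maps-from {y} y∈Y with y ∈? Y
    ... | yes y∈Y′ = proj₁ (proj₂ (surj y∈Y′))
    ... | no y∉Y   = ⊥-elim (y∉Y y∈Y)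

    inverseʳ : ∀ {y} → y ∈ Y → f (inverseOf y) ≡ y
    inverseʳ {y} y∈Y with y ∈? Y
    ... | yes y∈Y′ = proj₂ (proj₂ (surj y∈Y′))
    ... | no y∉Y   = ⊥-elim (y∉Y y∈Y)

    inverseˡ : ∀ {x} → x ∈ X → inverseOf (f x) ≡ x
    inverseˡ x∈X = inj (maps-from (maps x∈X)) x∈X (inverseʳ (maps x∈X))

-- Opaque, so that a case split on y ∈? X in a proof does not unfold piecewise in the goal.
opaque
  piecewise : FinSet → (ℕ → ℕ) → (ℕ → ℕ) → ℕ → ℕ
  piecewise X f g y = if does (y ∈? X) then f y else g y

  piecewise-∈ : ∀ {X f g y} → y ∈ X → piecewise X f g y ≡ f y
  piecewise-∈ {X} {y = y} y∈X with y ∈? X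
  ... | yes _   = refl
  ... | no y∉X  = ⊥-elim (y∉X y∈X)

  piecewise-∉ : ∀ {X f g y} → y ∉ X → piecewise X f g y ≡ g y
  piecewise-∉ {X} {y = y} y∉X with y ∈? X
  ... | yes y∈X = ⊥-elim (y∉X y∈X)
  ... | no _    = refl

∈-++₃⁻ : ∀ {x} (I J K : FinSet) → x ∈ I ++ (J ++ K) → x ∈ I ⊎ x ∈ J ⊎ x ∈ K
∈-++₃⁻ I J K x∈ with ∈-++⁻ I x∈
... | inj₁ x∈I   = inj₁ x∈I
... | inj₂ x∈JK  = inj₂ (∈-++⁻ J x∈JK)

∈-++₃⁺₂ : ∀ {x} (I : FinSet) {J} (K : FinSet) → x ∈ J → x ∈ I ++ (J ++ K)
∈-++₃⁺₂ I K x∈J = ∈-++⁺ʳ I (∈-++⁺ˡ x∈J)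

∈-++₃⁺₃ : ∀ {x} (I J : FinSet) {K} → x ∈ K → x ∈ I ++ (J ++ K)
∈-++₃⁺₃ I J x∈K = ∈-++⁺ʳ I (∈-++⁺ʳ J x∈K)

InBracket⇒InS : ∀ {I J K s} → InBracket I J K s → InS (I ++ (J ++ K)) s
InBracket⇒InS {I} {J} {K} (i , j , L′ , s≈ , i∈ , j∈ , i≢j , _ , L′⊆ , i∉ , j∉) =
  InS-resp-≈ᶜ (≈ᶜ-sym s≈) (∈-++⁺ˡ i∈ , ∈-++₃⁺₂ I K j∈ , i≢j , L′⊆ , i∉ , j∉)

InBracket-swap : ∀ {I J K s} → InBracket I J K s → InBracket J I K s
InBracket-swap {I} {J} {K} (i , j , L′ , s≈ , i∈ , j∈ , i≢j , K⊆ , L′⊆ , i∉ , j∉) =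
  j , i , L′ , ≈ᶜ-trans s≈ (inj₂ (refl , refl) , id , id) , j∈ , i∈ , i≢j ∘ sym ,
  K⊆ , swap-universe ∘ L′⊆ , j∉ , i∉
  where
  swap-universe : I ++ (J ++ K) ⊆ J ++ (I ++ K)
  swap-universe x∈ with ∈-++₃⁻ I J K x∈
  ... | inj₁ x∈I        = ∈-++₃⁺₂ J K x∈I
  ... | inj₂ (inj₁ x∈J) = ∈-++⁺ˡ x∈J
  ... | inj₂ (inj₂ x∈K) = ∈-++₃⁺₃ J I x∈K

InBracket-map : ∀ {I J K I′ J′ ρ s} →
                (∀ {x} → x ∈ I → ρ x ∈ I′) → (∀ {x} → x ∈ J → ρ x ∈ J′) →
                (∀ {x} → x ∈ K → ρ x ≡ x) → InjectiveOn ρ (I ++ (J ++ K)) →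
                InBracket I J K s → InBracket I′ J′ K (mapCI ρ s)
InBracket-map {I} {J} {K} {I′} {J′} {ρ} ρI ρJ ρK ρ-inj
              (i , j , L′ , s≈ , i∈ , j∈ , i≢j , K⊆ , L′⊆ , i∉ , j∉)
  with InS-mapCI maps-universe ρ-inj (∈-++⁺ˡ i∈ , ∈-++₃⁺₂ I K j∈ , i≢j , L′⊆ , i∉ , j∉)
  where
  maps-universe : ∀ {x} → x ∈ I ++ (J ++ K) → ρ x ∈ I′ ++ (J′ ++ K)
  maps-universe x∈ with ∈-++₃⁻ I J K x∈
  ... | inj₁ x∈I        = ∈-++⁺ˡ (ρI x∈I)
  ... | inj₂ (inj₁ x∈J) = ∈-++₃⁺₂ I′ K (ρJ x∈J)
  ... | inj₂ (inj₂ x∈K) = ∈-++₃⁺₃ I′ J′ (subst (_∈ K) (sym (ρK x∈K)) x∈K)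
... | _ , _ , ρi≢ρj , ρL′⊆ , ρi∉ , ρj∉ =
  ρ i , ρ j , map ρ L′ , mapCI-cong ρ s≈ , ρI i∈ , ρJ j∈ , ρi≢ρj ,
  (λ x∈K → subst (_∈ map ρ L′) (ρK x∈K) (∈-map⁺ ρ (K⊆ x∈K))) , ρL′⊆ , ρi∉ , ρj∉

subsets : List ℕ → List (List ℕ)
subsets []       = [] ∷ []
subsets (x ∷ xs) = subsets xs ++ map (x ∷_) (subsets xs)

subsets-⊆ : ∀ {S} U → S ∈ subsets U → S ⊆ U
subsets-⊆ [] (here refl) ()
subsets-⊆ (x ∷ U) S∈ with ∈-++⁻ (subsets U) S∈
... | inj₁ S∈U = there ∘ subsets-⊆ U S∈U
... | inj₂ S∈xU with ∈-map⁻ (x ∷_) S∈xU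
...   | S′ , S′∈U , refl = λ { (here refl) → here refl ; (there y∈S′) → there (subsets-⊆ U S′∈U y∈S′) }

filter-∈-subsets : ∀ {P : ℕ → Set} (P? : Decidable P) U → filter P? U ∈ subsets U
filter-∈-subsets P? []      = here refl
filter-∈-subsets P? (x ∷ U) with does (P? x)
... | false = ∈-++⁺ˡ (filter-∈-subsets P? U)
... | true  = ∈-++⁺ʳ (subsets U) (∈-map⁺ (x ∷_) (filter-∈-subsets P? U))

Admissible : FinSet → CI → Set
Admissible K ⟨ i , j ∣ L′ ⟩ = K ⊆ L′ × i ∉ L′ × j ∉ L′ × i ≢ j

admissible? : ∀ K → Decidable (Admissible K)
admissible? K ⟨ i , j ∣ L′ ⟩ = K ⊆? L′ ×-dec ¬? (i ∈? L′) ×-dec ¬? (j ∈? L′) ×-dec ¬? (i ≟ j)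

candidates : FinSet → FinSet → FinSet → Model
candidates I J U = cartesianProductWith (λ i (j , S) → ⟨ i , j ∣ S ⟩) I (cartesianProduct J (subsets U))

bracketList : FinSet → FinSet → FinSet → Model
bracketList I J K = filter (admissible? K) (candidates I J (I ++ (J ++ K)))

∈ₘ-bracketList⁺ : ∀ {I J K s} → InBracket I J K s → s ∈ₘ bracketList I J K
∈ₘ-bracketList⁺ {I} {J} {K} (i , j , L′ , s≈ , i∈ , j∈ , i≢j , K⊆ , L′⊆ , i∉ , j∉) =
  lose (∈-filter⁺ (admissible? K) candidate (proj₂ S≈L′ ∘ K⊆ , i∉ ∘ S⊆L′ , j∉ ∘ S⊆L′ , i≢j))
       (≈ᶜ-trans (inj₁ (refl , refl) , S≈L′) (≈ᶜ-sym s≈))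
  where
  S : FinSet
  S = filter (_∈? L′) (I ++ (J ++ K))
  S⊆L′ : S ⊆ L′
  S⊆L′ = proj₂ ∘ ∈-filter⁻ (_∈? L′) {xs = I ++ (J ++ K)}
  S≈L′ : S ⊆ L′ × L′ ⊆ S
  S≈L′ = S⊆L′ , λ x∈L′ → ∈-filter⁺ (_∈? L′) (L′⊆ x∈L′) x∈L′
  candidate : ⟨ i , j ∣ S ⟩ ∈ candidates I J (I ++ (J ++ K))
  candidate = ∈-cartesianProductWith⁺ _ i∈
                (∈-cartesianProduct⁺ j∈ (filter-∈-subsets (_∈? L′) (I ++ (J ++ K))))

∈ₘ-bracketList⁻ : ∀ {I J K s} → s ∈ₘ bracketList I J K → InBracket I J K s
∈ₘ-bracketList⁻ {I} {J} {K} s∈ with find s∈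
... | t , t∈ , t≈s with ∈-filter⁻ (admissible? K) t∈
...   | t∈cands , admissible with ∈-cartesianProductWith⁻ _ I _ t∈cands
...     | i , (j , S) , i∈ , jS∈ , refl with ∈-cartesianProduct⁻ J _ jS∈
...       | j∈ , S∈ with admissible
...         | K⊆ , i∉ , j∉ , i≢j =
  i , j , S , ≈ᶜ-sym t≈s , i∈ , j∈ , i≢j , K⊆ , subsets-⊆ (I ++ (J ++ K)) S∈ , i∉ , j∉

module _ {𝔉 : Frame} (isF : IsCIFrame 𝔉) (cInter : ClosedInter 𝔉) {X : FinSet} {P : CI → Set}
         (Zs : Model) (P⇒Zs : ∀ s → P s → s ∈ₘ Zs) (Zs⇒P : ∀ s → s ∈ₘ Zs → P s) where

  private
    Contains : Model → Set
    Contains B = ∀ s → P s → s ∈ₘ B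

    contains? : ∀ B → Dec (Contains B)
    contains? B = map′ (λ Zs⊆B s → Zs⊆B s ∘ P⇒Zs s) (λ B⊇P s → B⊇P s ∘ Zs⇒P s) (Zs ⊆ₘ? B)

  meet-of-containing : (Bs : List Model) → (∀ B → B ∈F Bs → B ∈F 𝔉 X) →
                       (C₀ : Model) → C₀ ∈F 𝔉 X → Contains C₀ →
                       Σ Model λ C → C ∈F 𝔉 X × Contains C × C ⊆ₘ C₀ ×
                                     (∀ B → B ∈F Bs → Contains B → C ⊆ₘ B)
  meet-of-containing [] _ C₀ C₀∈ C₀⊇P = C₀ , C₀∈ , C₀⊇P , ⊆ₘ-refl , λ _ ()
  meet-of-containing (B ∷ Bs) Bs⊆𝔉 C₀ C₀∈ C₀⊇P with contains? B
  ... | no B⊉P =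
    let C , C∈ , C⊇P , C⊆C₀ , C-least = meet-of-containing Bs (λ B′ → Bs⊆𝔉 B′ ∘ there) C₀ C₀∈ C₀⊇P
    in  C , C∈ , C⊇P , C⊆C₀ ,
        λ { B′ (here (_ , B′⊆B)) B′⊇P → ⊥-elim (B⊉P (λ s → B′⊆B s ∘ B′⊇P s))
          ; B′ (there B′∈Bs)          → C-least B′ B′∈Bs }
  ... | yes B⊇P =
    let C₁ , C₁∈ , C₁≡C₀∩B = cInter X C₀ B C₀∈ (Bs⊆𝔉 B (here (⊆ₘ-refl , ⊆ₘ-refl)))
        C₁⊆C₀∩B : ∀ s → s ∈ₘ C₁ → s ∈ₘ C₀ × s ∈ₘ B
        C₁⊆C₀∩B s = Equivalence.to (C₁≡C₀∩B s)
        C , C∈ , C⊇P , C⊆C₁ , C-least =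
          meet-of-containing Bs (λ B′ → Bs⊆𝔉 B′ ∘ there) C₁ C₁∈
            (λ s Ps → Equivalence.from (C₁≡C₀∩B s) (C₀⊇P s Ps , B⊇P s Ps))
    in  C , C∈ , C⊇P , (λ s → proj₁ ∘ C₁⊆C₀∩B s ∘ C⊆C₁ s) ,
        λ { B′ (here (B⊆B′ , _)) _ s → B⊆B′ s ∘ proj₂ ∘ C₁⊆C₀∩B s ∘ C⊆C₁ s
          ; B′ (there B′∈Bs)         → C-least B′ B′∈Bs }

  closure-of-listed : (∀ s → P s → InS X s) → Σ Model (IsClosure 𝔉 X P)
  closure-of-listed P⊆X =
    let F , F∈ , F-full = IsCIFrame.full isF X
        C , C∈ , C⊇P , _ , C-least = meet-of-containing (𝔉 X) (λ _ → id) F F∈ (λ s → F-full s ∘ P⊆X s)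
    in  C , C∈ , C⊇P , C-least

∈ₘ-closure-transport : ∀ {𝔉 X Y f g P Q C D} → IsCIFrame 𝔉 → ClosedCopy 𝔉 → InverseOn f g X Y →
                       IsClosure 𝔉 X P C → IsClosure 𝔉 Y Q D →
                       (∀ s → Q s → InS Y s) → (∀ s → Q s → P (mapCI g s)) →
                       ∀ {s} → s ∈ₘ D → mapCI g s ∈ₘ C
∈ₘ-closure-transport {𝔉} {X} {Y} {f} {Q = Q} {C} isF cCopy f↔g
                     (C∈ , C⊇P , _) (_ , _ , D-least) Q⊆Y Q⇒Pg {s} =
  ∈ₘ-mapM⁻-inverse (IsCIFrame.over isF X C C∈) ∘ D-least (mapM f C) fC∈ D⊆fC s
  where
  open InverseOn f↔g
  fC∈ : mapM f C ∈F 𝔉 Y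
  fC∈ = cCopy X Y f C isBij C∈
  D⊆fC : ∀ t → Q t → t ∈ₘ mapM f C
  D⊆fC t Qt = ∈ₘ-mapM⁺-inverse (Q⊆Y t Qt) (C⊇P _ (Q⇒Pg t Qt))

record Copy (N L : FinSet) : Set where
  constructor mkCopy
  field
    M     : FinSet
    φ     : ℕ → ℕ
    bij   : IsBij φ N M
    inter : InterIs N M L
    fix   : FixesOn φ L

∈-∖⁺ : ∀ {X Y x} → x ∈ X → x ∉ Y → x ∈ X ∖ Y
∈-∖⁺ {Y = Y} = ∈-filter⁺ (λ x → ¬? (x ∈? Y))

∈-∖⁻ : ∀ {X Y x} → x ∈ X ∖ Y → x ∈ X × x ∉ Y
∈-∖⁻ {X} {Y} = ∈-filter⁻ (λ x → ¬? (x ∈? Y)) {xs = X}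

module CopyProperties {N L : FinSet} (c : Copy N L) where
  open Copy c public

  φ⁻¹ : ℕ → ℕ
  φ⁻¹ = inverseOf bij

  φ↔φ⁻¹ : InverseOn φ φ⁻¹ N M
  φ↔φ⁻¹ = IsBij⇒InverseOn bij

  open InverseOn φ↔φ⁻¹ public using () renaming
    (maps-to to φ-∈; maps-from to φ⁻¹-∈; inverseˡ to φ⁻¹∘φ; inverseʳ to φ∘φ⁻¹)

  ∈L⇒∈N : ∀ {x} → x ∈ L → x ∈ N
  ∈L⇒∈N {x} = proj₁ ∘ Equivalence.from (inter x)

  ∈L⇒∈M : ∀ {x} → x ∈ L → x ∈ M
  ∈L⇒∈M {x} = proj₂ ∘ Equivalence.from (inter x)

  ∈N∩M⇒∈L : ∀ {x} → x ∈ N → x ∈ M → x ∈ L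
  ∈N∩M⇒∈L {x} x∈N x∈M = Equivalence.to (inter x) (x∈N , x∈M)

  ∉L⇒∉M : ∀ {x} → x ∈ N → x ∉ L → x ∉ M
  ∉L⇒∉M x∈N x∉L = x∉L ∘ ∈N∩M⇒∈L x∈N

  ∈N∪M⇒∉N⇒∈M : ∀ {x} → x ∈ N ++ M → x ∉ N → x ∈ M
  ∈N∪M⇒∉N⇒∈M x∈ x∉N with ∈-++⁻ N x∈
  ... | inj₁ x∈N = ⊥-elim (x∉N x∈N)
  ... | inj₂ x∈M = x∈M

  φ⁻¹-fix : ∀ {x} → x ∈ L → φ⁻¹ x ≡ x
  φ⁻¹-fix {x} x∈L = begin
    φ⁻¹ x      ≡⟨ cong φ⁻¹ (fix x x∈L) ⟨
    φ⁻¹ (φ x)  ≡⟨ φ⁻¹∘φ (∈L⇒∈N x∈L) ⟩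
    x          ∎
    where open ≡-Reasoning

  φ-∉N : ∀ {x} → x ∈ N → x ∉ L → φ x ∉ N
  φ-∉N {x} x∈N x∉L φx∈N = x∉L (subst (_∈ L) φx≡x φx∈L)
    where
    φx∈L : φ x ∈ L
    φx∈L = ∈N∩M⇒∈L φx∈N (φ-∈ x∈N)
    φx≡x : φ x ≡ x
    φx≡x = IsBij.inj bij φx∈N x∈N (fix (φ x) φx∈L)

  φ⁻¹-∉L : ∀ {y} → y ∈ M → y ∉ N → φ⁻¹ y ∉ L
  φ⁻¹-∉L {y} y∈M y∉N φ⁻¹y∈L = y∉N (subst (_∈ N) φ⁻¹y≡y (∈L⇒∈N φ⁻¹y∈L))
    where
    φ⁻¹y≡y : φ⁻¹ y ≡ y
    φ⁻¹y≡y = trans (sym (fix _ φ⁻¹y∈L)) (φ∘φ⁻¹ y∈M)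

  φ-∖ : ∀ {x} → x ∈ N ∖ M → φ x ∈ M ∖ N
  φ-∖ x∈ with ∈-∖⁻ {N} x∈
  ... | x∈N , x∉M = ∈-∖⁺ (φ-∈ x∈N) (φ-∉N x∈N (x∉M ∘ ∈L⇒∈M))

  φ⁻¹-∖ : ∀ {y} → y ∈ M ∖ N → φ⁻¹ y ∈ N ∖ M
  φ⁻¹-∖ y∈ with ∈-∖⁻ {M} y∈
  ... | y∈M , y∉N = ∈-∖⁺ (φ⁻¹-∈ y∈M) (∉L⇒∉M (φ⁻¹-∈ y∈M) (φ⁻¹-∉L y∈M y∉N))

  bracket-universe⊆ : (N ∖ M) ++ ((M ∖ N) ++ L) ⊆ N ++ M
  bracket-universe⊆ x∈ with ∈-++₃⁻ (N ∖ M) (M ∖ N) L x∈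
  ... | inj₁ x∈N∖M        = ∈-++⁺ˡ (proj₁ (∈-∖⁻ {N} x∈N∖M))
  ... | inj₂ (inj₁ x∈M∖N) = ∈-++⁺ʳ N (proj₁ (∈-∖⁻ {M} x∈M∖N))
  ... | inj₂ (inj₂ x∈L)   = ∈-++⁺ˡ (∈L⇒∈N x∈L)

  swap : ℕ → ℕ
  swap = piecewise N φ φ⁻¹

  swap-on-N : ∀ {x} → x ∈ N → swap x ≡ φ x
  swap-on-N = piecewise-∈

  swap-on-M : ∀ {y} → y ∈ M → swap y ≡ φ⁻¹ y
  swap-on-M {y} y∈M with y ∈? N
  ... | no y∉N  = piecewise-∉ y∉N
  ... | yes y∈N = begin
    swap y  ≡⟨ piecewise-∈ y∈N ⟩
    φ y     ≡⟨ fix y y∈L ⟩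
    y       ≡⟨ φ⁻¹-fix y∈L ⟨
    φ⁻¹ y   ∎
    where
    open ≡-Reasoning
    y∈L : y ∈ L
    y∈L = ∈N∩M⇒∈L y∈N y∈M

  swap-fix : ∀ {x} → x ∈ L → swap x ≡ x
  swap-fix {x} x∈L = trans (swap-on-N (∈L⇒∈N x∈L)) (fix x x∈L)

  swap-involution : InverseOn swap swap (N ++ M) (N ++ M)
  swap-involution = record
    { maps-to = swap-∈ ; maps-from = swap-∈ ; inverseˡ = swap∘swap ; inverseʳ = swap∘swap }
    where
    swap-∈ : ∀ {y} → y ∈ N ++ M → swap y ∈ N ++ M
    swap-∈ {y} y∈ with y ∈? N
    ... | yes y∈N = subst (_∈ N ++ M) (sym (swap-on-N y∈N)) (∈-++⁺ʳ N (φ-∈ y∈N))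
    ... | no y∉N  = subst (_∈ N ++ M) (sym (swap-on-M y∈M)) (∈-++⁺ˡ (φ⁻¹-∈ y∈M))
      where
      y∈M : y ∈ M
      y∈M = ∈N∪M⇒∉N⇒∈M y∈ y∉N

    swap∘swap : ∀ {y} → y ∈ N ++ M → swap (swap y) ≡ y
    swap∘swap {y} y∈ with y ∈? N
    ... | yes y∈N = begin
      swap (swap y)  ≡⟨ cong swap (swap-on-N y∈N) ⟩
      swap (φ y)     ≡⟨ swap-on-M (φ-∈ y∈N) ⟩
      φ⁻¹ (φ y)      ≡⟨ φ⁻¹∘φ y∈N ⟩
      y              ∎
      where open ≡-Reasoning
    ... | no y∉N = begin
      swap (swap y)  ≡⟨ cong swap (swap-on-M y∈M) ⟩
      swap (φ⁻¹ y)   ≡⟨ swap-on-N (φ⁻¹-∈ y∈M) ⟩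
      φ (φ⁻¹ y)      ≡⟨ φ∘φ⁻¹ y∈M ⟩
      y              ∎
      where
      open ≡-Reasoning
      y∈M : y ∈ M
      y∈M = ∈N∪M⇒∉N⇒∈M y∈ y∉N

  swap-∖NM : ∀ {x} → x ∈ N ∖ M → swap x ∈ M ∖ N
  swap-∖NM x∈ = subst (_∈ M ∖ N) (sym (swap-on-N (proj₁ (∈-∖⁻ {N} x∈)))) (φ-∖ x∈)

  swap-∖MN : ∀ {y} → y ∈ M ∖ N → swap y ∈ N ∖ M
  swap-∖MN y∈ = subst (_∈ N ∖ M) (sym (swap-on-M (proj₁ (∈-∖⁻ {M} y∈)))) (φ⁻¹-∖ y∈)

module Transfer {N L : FinSet} (c d : Copy N L) where
  private
    module C = CopyProperties c
    module D = CopyProperties d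

  transfer : ℕ → ℕ
  transfer = piecewise N id (D.φ ∘ C.φ⁻¹)

  transfer-on-N : ∀ {x} → x ∈ N → transfer x ≡ x
  transfer-on-N = piecewise-∈

  transfer-fix : ∀ {x} → x ∈ L → transfer x ≡ x
  transfer-fix = transfer-on-N ∘ C.∈L⇒∈N

  transfer-∈ : ∀ {y} → y ∈ N ++ C.M → transfer y ∈ N ++ D.M
  transfer-∈ {y} y∈ with y ∈? N
  ... | yes y∈N = subst (_∈ N ++ D.M) (sym (transfer-on-N y∈N)) (∈-++⁺ˡ y∈N)
  ... | no y∉N  = subst (_∈ N ++ D.M) (sym (piecewise-∉ y∉N))
                    (∈-++⁺ʳ N (D.φ-∈ (C.φ⁻¹-∈ (C.∈N∪M⇒∉N⇒∈M y∈ y∉N))))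

  transfer-φ : ∀ {x} → x ∈ N → transfer (C.φ x) ≡ D.φ x
  transfer-φ {x} x∈N with x ∈? L
  ... | yes x∈L = begin
    transfer (C.φ x)  ≡⟨ cong transfer (C.fix x x∈L) ⟩
    transfer x        ≡⟨ transfer-fix x∈L ⟩
    x                 ≡⟨ D.fix x x∈L ⟨
    D.φ x             ∎
    where open ≡-Reasoning
  ... | no x∉L = begin
    transfer (C.φ x)       ≡⟨ piecewise-∉ (C.φ-∉N x∈N x∉L) ⟩
    D.φ (C.φ⁻¹ (C.φ x))    ≡⟨ cong D.φ (C.φ⁻¹∘φ x∈N) ⟩
    D.φ x                  ∎
    where open ≡-Reasoning

  transfer-∖NM : ∀ {x} → x ∈ N ∖ C.M → transfer x ∈ N ∖ D.M
  transfer-∖NM x∈ with ∈-∖⁻ {N} x∈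
  ... | x∈N , x∉M = subst (_∈ N ∖ D.M) (sym (transfer-on-N x∈N))
                      (∈-∖⁺ x∈N (D.∉L⇒∉M x∈N (x∉M ∘ C.∈L⇒∈M)))

  transfer-∖MN : ∀ {y} → y ∈ C.M ∖ N → transfer y ∈ D.M ∖ N
  transfer-∖MN {y} y∈ with ∈-∖⁻ {C.M} y∈
  ... | y∈M , y∉N = subst (_∈ D.M ∖ N) (sym (piecewise-∉ y∉N))
                      (∈-∖⁺ (D.φ-∈ x∈N) (D.φ-∉N x∈N (C.φ⁻¹-∉L y∈M y∉N)))
    where
    x∈N : C.φ⁻¹ y ∈ N
    x∈N = C.φ⁻¹-∈ y∈M

  transfer⁻¹ : ℕ → ℕ
  transfer⁻¹ = piecewise N id (C.φ ∘ D.φ⁻¹)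

  transfer⁻¹∘transfer : ∀ {y} → y ∈ N ++ C.M → transfer⁻¹ (transfer y) ≡ y
  transfer⁻¹∘transfer {y} y∈ with y ∈? N
  ... | yes y∈N = trans (cong transfer⁻¹ (transfer-on-N y∈N)) (piecewise-∈ y∈N)
  ... | no y∉N = begin
    transfer⁻¹ (transfer y)        ≡⟨ cong transfer⁻¹ (piecewise-∉ y∉N) ⟩
    transfer⁻¹ (D.φ (C.φ⁻¹ y))     ≡⟨ piecewise-∉ (D.φ-∉N x∈N (C.φ⁻¹-∉L y∈M y∉N)) ⟩
    C.φ (D.φ⁻¹ (D.φ (C.φ⁻¹ y)))    ≡⟨ cong C.φ (D.φ⁻¹∘φ x∈N) ⟩
    C.φ (C.φ⁻¹ y)                  ≡⟨ C.φ∘φ⁻¹ y∈M ⟩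
    y                              ∎
    where
    open ≡-Reasoning
    y∈M : y ∈ C.M
    y∈M = C.∈N∪M⇒∉N⇒∈M y∈ y∉N
    x∈N : C.φ⁻¹ y ∈ N
    x∈N = C.φ⁻¹-∈ y∈M

transfer-inverse : ∀ {N L} (c d : Copy N L) →
                   InverseOn (Transfer.transfer c d) (Transfer.transfer d c)
                             (N ++ Copy.M c) (N ++ Copy.M d)
transfer-inverse c d = record
  { maps-to   = Transfer.transfer-∈ c d
  ; maps-from = Transfer.transfer-∈ d c
  ; inverseˡ  = Transfer.transfer⁻¹∘transfer c d
  ; inverseʳ  = Transfer.transfer⁻¹∘transfer d c
  }

module _ {N L : FinSet} (L⊆N : L ⊆ N) where
  private
    k : ℕ
    k = suc (max 0 N)

    k+-∉N : ∀ y → k + y ∉ N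
    k+-∉N y k+y∈N = <⇒≱ (s≤s (All.lookup (xs≤max 0 N) k+y∈N)) (m≤m+n k y)

    shift : ℕ → ℕ
    shift = piecewise L id (k +_)

    shift-∉N : ∀ {x} → x ∉ L → shift x ∉ N
    shift-∉N {x} x∉L = subst (_∉ N) (sym (piecewise-∉ x∉L)) (k+-∉N x)

    shift-∈N⇒∈L : ∀ {x} → x ∈ N → shift x ∈ N → x ∈ L
    shift-∈N⇒∈L {x} x∈N sx∈N with x ∈? L
    ... | yes x∈L = x∈L
    ... | no x∉L  = ⊥-elim (shift-∉N x∉L sx∈N)

    shift-inj : InjectiveOn shift N
    shift-inj {x} {y} x∈N y∈N sx≡sy with x ∈? L | y ∈? L
    ... | yes x∈L | yes y∈L = trans (sym (piecewise-∈ x∈L)) (trans sx≡sy (piecewise-∈ y∈L))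
    ... | yes x∈L | no y∉L  =
      ⊥-elim (shift-∉N y∉L (subst (_∈ N) (trans (sym (piecewise-∈ x∈L)) sx≡sy) x∈N))
    ... | no x∉L  | yes y∈L =
      ⊥-elim (shift-∉N x∉L (subst (_∈ N) (trans (sym (piecewise-∈ y∈L)) (sym sx≡sy)) y∈N))
    ... | no x∉L  | no y∉L  =
      +-cancelˡ-≡ k x y (trans (sym (piecewise-∉ x∉L)) (trans sx≡sy (piecewise-∉ y∉L)))

  freshCopy : Copy N L
  freshCopy = record
    { M     = map shift N
    ; φ     = shift
    ; bij   = record { maps = ∈-map⁺ shift ; inj = shift-inj ; surj = surj }
    ; inter = λ x → mk⇔ (to x) (from x)
    ; fix   = λ x → piecewise-∈
    }
    where
    surj : ∀ {y} → y ∈ map shift N → Σ ℕ λ x → x ∈ N × shift x ≡ y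
    surj y∈ = let x , x∈N , y≡sx = ∈-map⁻ shift y∈ in x , x∈N , sym y≡sx

    to : ∀ x → x ∈ N × x ∈ map shift N → x ∈ L
    to x (x∈N , x∈sN) with ∈-map⁻ shift x∈sN
    ... | y , y∈N , refl = subst (_∈ L) (sym (piecewise-∈ y∈L)) y∈L
      where
      y∈L : y ∈ L
      y∈L = shift-∈N⇒∈L y∈N x∈N

    from : ∀ x → x ∈ L → x ∈ N × x ∈ map shift N
    from x x∈L = L⊆N x∈L , subst (_∈ map shift N) (piecewise-∈ x∈L) (∈-map⁺ shift (L⊆N x∈L))

module ZProperties {N L : FinSet} (𝓜 : Model) (𝓜⊆N : Over N 𝓜) where

  Z : Copy N L → CI → Set
  Z c = ZPred 𝓜 (Copy.φ c) N (Copy.M c) L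

  zList : Copy N L → Model
  zList c = 𝓜 ++ (mapM φ 𝓜 ++ bracketList (N ∖ M) (M ∖ N) L)
    where open Copy c

  Z⇒zList : ∀ c s → Z c s → s ∈ₘ zList c
  Z⇒zList c s (inj₁ s∈𝓜)         = ++⁺ˡ s∈𝓜
  Z⇒zList c s (inj₂ (inj₁ s∈φ𝓜)) = ++⁺ʳ 𝓜 (++⁺ˡ s∈φ𝓜)
  Z⇒zList c s (inj₂ (inj₂ s∈br)) = ++⁺ʳ 𝓜 (++⁺ʳ (mapM (Copy.φ c) 𝓜) (∈ₘ-bracketList⁺ s∈br))

  zList⇒Z : ∀ c s → s ∈ₘ zList c → Z c s
  zList⇒Z c s s∈ with ++⁻ 𝓜 s∈
  ... | inj₁ s∈𝓜 = inj₁ s∈𝓜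
  ... | inj₂ s∈  with ++⁻ (mapM (Copy.φ c) 𝓜) s∈
  ...   | inj₁ s∈φ𝓜 = inj₂ (inj₁ s∈φ𝓜)
  ...   | inj₂ s∈br  = inj₂ (inj₂ (∈ₘ-bracketList⁻ s∈br))

  Z⊆N∪M : ∀ c s → Z c s → InS (N ++ Copy.M c) s
  Z⊆N∪M c s (inj₁ s∈𝓜)         = InS-mono ∈-++⁺ˡ (𝓜⊆N s s∈𝓜)
  Z⊆N∪M c s (inj₂ (inj₁ s∈φ𝓜)) =
    InS-mono (∈-++⁺ʳ N) (Over-mapM (CopyProperties.φ-∈ c) (IsBij.inj (Copy.bij c)) 𝓜⊆N s s∈φ𝓜)
  Z⊆N∪M c s (inj₂ (inj₂ s∈br)) = InS-mono (CopyProperties.bracket-universe⊆ c) (InBracket⇒InS s∈br)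

  Z-swap : ∀ c s → Z c s → Z c (mapCI (CopyProperties.swap c) s)
  Z-swap c s (inj₁ s∈𝓜)         = inj₂ (inj₁ (∈ₘ-mapM-∘ 𝓜⊆N swap-on-N (∈ₘ-mapM-id⁺ s∈𝓜)))
    where open CopyProperties c
  Z-swap c s (inj₂ (inj₁ s∈φ𝓜)) = inj₁ (∈ₘ-mapM-id⁻ (∈ₘ-mapM-∘ 𝓜⊆N swap∘φ s∈φ𝓜))
    where
    open CopyProperties c
    swap∘φ : ∀ {x} → x ∈ N → swap (φ x) ≡ x
    swap∘φ x∈N = trans (swap-on-M (φ-∈ x∈N)) (φ⁻¹∘φ x∈N)
  Z-swap c s (inj₂ (inj₂ s∈br)) =
    inj₂ (inj₂ (InBracket-swap (InBracket-map swap-∖NM swap-∖MN swap-fix swap-inj s∈br)))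
    where
    open CopyProperties c
    swap-inj : InjectiveOn swap ((N ∖ M) ++ ((M ∖ N) ++ L))
    swap-inj x∈ y∈ = InverseOn.injective swap-involution (bracket-universe⊆ x∈) (bracket-universe⊆ y∈)

  Z⊆witness : ∀ c {B W} → 𝓜 ⊆ₘ B → IsMarg B W N → IsMarg (mapM (Copy.φ c) B) W (Copy.M c) →
              Perp (N ∖ Copy.M c) (Copy.M c ∖ N) L W → ∀ s → Z c s → s ∈ₘ W
  Z⊆witness c 𝓜⊆B B-marg φB-marg W-perp s (inj₁ s∈𝓜)         =
    proj₁ (Equivalence.to (B-marg s) (𝓜⊆B s s∈𝓜))
  Z⊆witness c 𝓜⊆B B-marg φB-marg W-perp s (inj₂ (inj₁ s∈φ𝓜)) =
    proj₁ (Equivalence.to (φB-marg s) (mapM-mono (Copy.φ c) 𝓜⊆B s s∈φ𝓜))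
  Z⊆witness c 𝓜⊆B B-marg φB-marg W-perp s (inj₂ (inj₂ s∈br)) = W-perp s s∈br

  Z-transfer : ∀ c d s → Z c s → Z d (mapCI (Transfer.transfer c d) s)
  Z-transfer c d s (inj₁ s∈𝓜) =
    inj₁ (∈ₘ-mapM-id⁻ (∈ₘ-mapM-∘ 𝓜⊆N transfer-on-N (∈ₘ-mapM-id⁺ s∈𝓜)))
    where open Transfer c d
  Z-transfer c d s (inj₂ (inj₁ s∈φ𝓜)) = inj₂ (inj₁ (∈ₘ-mapM-∘ 𝓜⊆N transfer-φ s∈φ𝓜))
    where open Transfer c d
  Z-transfer c d s (inj₂ (inj₂ s∈br)) =
    inj₂ (inj₂ (InBracket-map transfer-∖NM transfer-∖MN transfer-fix transfer-inj s∈br))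
    where
    open Transfer c d
    transfer-inj : InjectiveOn transfer ((N ∖ Copy.M c) ++ ((Copy.M c ∖ N) ++ L))
    transfer-inj x∈ y∈ = InverseOn.injective (transfer-inverse c d) (universe⊆ x∈) (universe⊆ y∈)
      where open CopyProperties c using () renaming (bracket-universe⊆ to universe⊆)

IsMarg-resp-≐ : ∀ {A B C X} → IsMarg A C X → A ≐ B → IsMarg B C X
IsMarg-resp-≐ A-marg (A⊆B , B⊆A) s =
  mk⇔ (Equivalence.to (A-marg s) ∘ B⊆A s) (A⊆B s ∘ Equivalence.from (A-marg s))

module Adhesion {𝔉 : Frame} (isF : IsCIFrame 𝔉) (cCopy : ClosedCopy 𝔉) (cMarg : ClosedMarg 𝔉)
                (cInter : ClosedInter 𝔉) {N L : FinSet} {𝓜 : Model} (𝓜⊆N : Over N 𝓜) where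
  open ZProperties {L = L} 𝓜 𝓜⊆N

  closureZ : ∀ c → Σ Model (IsClosure 𝔉 (N ++ Copy.M c) (Z c))
  closureZ c = closure-of-listed isF cInter (zList c) (Z⇒zList c) (zList⇒Z c) (Z⊆N∪M c)

  Cl : Copy N L → Model
  Cl c = proj₁ (closureZ c)

  Cl-isClosure : ∀ c → IsClosure 𝔉 (N ++ Copy.M c) (Z c) (Cl c)
  Cl-isClosure c = proj₂ (closureZ c)

  Cl-∈ : ∀ c → Cl c ∈F 𝔉 (N ++ Copy.M c)
  Cl-∈ c = proj₁ (Cl-isClosure c)

  Z⊆Cl : ∀ c s → Z c s → s ∈ₘ Cl c
  Z⊆Cl c = proj₁ (proj₂ (Cl-isClosure c))

  marginalN : ∀ c → Σ Model λ A → A ∈F 𝔉 N × IsMarg A (Cl c) N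
  marginalN c = cMarg (N ++ Copy.M c) N (Cl c) ∈-++⁺ˡ (Cl-∈ c)

  Cl↓N : Copy N L → Model
  Cl↓N c = proj₁ (marginalN c)

  Cl↓N-∈ : ∀ c → Cl↓N c ∈F 𝔉 N
  Cl↓N-∈ c = proj₁ (proj₂ (marginalN c))

  Cl↓N-marg : ∀ c → IsMarg (Cl↓N c) (Cl c) N
  Cl↓N-marg c = proj₂ (proj₂ (marginalN c))

  Cl-perp : ∀ c → Perp (N ∖ Copy.M c) (Copy.M c ∖ N) L (Cl c)
  Cl-perp c s s∈br = Z⊆Cl c s (inj₂ (inj₂ s∈br))

  𝓜⊆Cl↓N : ∀ c → 𝓜 ⊆ₘ Cl↓N c
  𝓜⊆Cl↓N c s s∈𝓜 = Equivalence.from (Cl↓N-marg c s) (Z⊆Cl c s (inj₁ s∈𝓜) , 𝓜⊆N s s∈𝓜)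

  Cl↓N-least : ∀ c B → B ∈F 𝔉 N → 𝓜 ⊆ₘ B → SelfAdhesive 𝔉 N L B → Cl↓N c ⊆ₘ B
  Cl↓N-least c B _ 𝓜⊆B B-sa s s∈Cl↓N =
    let open Copy c
        W , W∈ , B-marg , φB-marg , W-perp = B-sa M φ bij inter fix
        s∈Cl , s∈N = Equivalence.to (Cl↓N-marg c s) s∈Cl↓N
        Cl⊆W = proj₂ (proj₂ (Cl-isClosure c)) W W∈ (Z⊆witness c 𝓜⊆B B-marg φB-marg W-perp)
    in  Equivalence.from (B-marg s) (Cl⊆W s s∈Cl , s∈N)

  Cl-swap-stable : ∀ c {s} → s ∈ₘ Cl c → mapCI (CopyProperties.swap c) s ∈ₘ Cl c
  Cl-swap-stable c = ∈ₘ-closure-transport isF cCopy (CopyProperties.swap-involution c)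
                       (Cl-isClosure c) (Cl-isClosure c) (Z⊆N∪M c) (Z-swap c)

  φCl↓N-marg : ∀ c → IsMarg (mapM (Copy.φ c) (Cl↓N c)) (Cl c) (Copy.M c)
  φCl↓N-marg c s = mk⇔ to from
    where
    open CopyProperties c
    Cl↓N⊆N : Over N (Cl↓N c)
    Cl↓N⊆N t = proj₂ ∘ Equivalence.to (Cl↓N-marg c t)

    to : s ∈ₘ mapM φ (Cl↓N c) → s ∈ₘ Cl c × InS M s
    to s∈ =
      let a , a∈Cl↓N , φa≈s = ∈ₘ-mapM⁻ φ s∈
          a∈Cl , a∈N = Equivalence.to (Cl↓N-marg c a) a∈Cl↓N
      in  ∈ₘ-resp-≈ᶜ φa≈s (subst (_∈ₘ Cl c) (mapCI-cong-on swap-on-N a∈N) (Cl-swap-stable c a∈Cl)) ,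
          Over-mapM φ-∈ (IsBij.inj bij) Cl↓N⊆N s s∈

    from : s ∈ₘ Cl c × InS M s → s ∈ₘ mapM φ (Cl↓N c)
    from (s∈Cl , s∈M) = InverseOn.∈ₘ-mapM⁺-inverse φ↔φ⁻¹ s∈M (Equivalence.from (Cl↓N-marg c _)
      (subst (_∈ₘ Cl c) (mapCI-cong-on swap-on-M s∈M) (Cl-swap-stable c s∈Cl) ,
       InS-mapCI φ⁻¹-∈ (InverseOn.injective (InverseOn.flip φ↔φ⁻¹)) s∈M))

  Cl↓N-independent : ∀ c d → Cl↓N d ⊆ₘ Cl↓N c
  Cl↓N-independent c d s s∈Cl↓N =
    let s∈Cl , s∈N = Equivalence.to (Cl↓N-marg d s) s∈Cl↓N
        ts∈Cl = ∈ₘ-closure-transport isF cCopy (transfer-inverse c d)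
                  (Cl-isClosure c) (Cl-isClosure d) (Z⊆N∪M d) (Z-transfer d c) s∈Cl
    in  Equivalence.from (Cl↓N-marg c s)
          (subst (_∈ₘ Cl c) (mapCI-id-on (Transfer.transfer-on-N d c) s∈N) ts∈Cl , s∈N)

  Cl↓N-marginal-of : ∀ c d → IsMarg (Cl↓N c) (Cl d) N
  Cl↓N-marginal-of c d = IsMarg-resp-≐ (Cl↓N-marg d) (Cl↓N-independent c d , Cl↓N-independent d c)

  Cl↓N-selfAdhesive : ∀ c → SelfAdhesive 𝔉 N L (Cl↓N c)
  Cl↓N-selfAdhesive c M φ bij inter fix =
    Cl d , Cl-∈ d , Cl↓N-marginal-of c d ,
    IsMarg-resp-≐ (φCl↓N-marg d)
      (mapM-mono φ (Cl↓N-independent c d) , mapM-mono φ (Cl↓N-independent d c)) ,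
    Cl-perp d
    where
    d : Copy N L
    d = mkCopy M φ bij inter fix

lemma4p5 : (𝔉 : Frame) → IsCIFrame 𝔉 → ClosedCopy 𝔉 → ClosedMarg 𝔉 →
           ClosedInter 𝔉 → ClosedAscetic 𝔉 →
           (N : FinSet) (𝓜 : Model) → Over N 𝓜 → (L : FinSet) → L ⊆ N →
           Σ Model (λ A → IsSAClosure 𝔉 N L 𝓜 A ×
             (∀ M φ → IsBij φ N M → InterIs N M L → FixesOn φ L →
               Σ Model (λ C → IsClosure 𝔉 (N ++ M) (ZPred 𝓜 φ N M L) C ×
                              IsMarg A C N)))
lemma4p5 𝔉 isF cCopy cMarg cInter _ N 𝓜 𝓜⊆N L L⊆N =
  Cl↓N c₀ , ((Cl↓N-∈ c₀ , 𝓜⊆Cl↓N c₀ , Cl↓N-selfAdhesive c₀) , Cl↓N-least c₀) , closure-formula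
  where
  open Adhesion isF cCopy cMarg cInter {L = L} 𝓜⊆N

  c₀ : Copy N L
  c₀ = freshCopy L⊆N

  closure-formula : ∀ M φ → IsBij φ N M → InterIs N M L → FixesOn φ L →
                    Σ Model λ C → IsClosure 𝔉 (N ++ M) (ZPred 𝓜 φ N M L) C × IsMarg (Cl↓N c₀) C N
  closure-formula M φ bij inter fix =
    let d = mkCopy M φ bij inter fix in Cl d , Cl-isClosure d , Cl↓N-marginal-of c₀ d
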